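{- Let $\Sigma$ be a totally ordered alphabet, $w \ge 1$ an integer, $E \subseteq \Sigma^w$ any set of strings of length $w$, and $E' = E \cup \{\mathtt{\#}, \mathtt{\$}^w\}$, where $\mathtt{\#}$ and $\mathtt{\$}$ are special symbols not in $\Sigma$ that are lexicographically smaller than every symbol of $\Sigma$. Let $T[0..n-1]$ be a string over $\Sigma$ and $T'[0..n] = T\,\mathtt{\$}$. Let $D$ be the maximal set of strings $d$ such that: $d$ is a substring of $\mathtt{\#}\,T\,\mathtt{\$}^w$; exactly one proper prefix of $d$ is in $E'$; exactly one proper suffix of $d$ is in $E'$; and no other substring of $d$ is in $E'$. Let $S$ be the set of all suffixes of elements of $D$ of length greater than $w$. For each suffix $x$ of $\mathtt{\#}\,T\,\mathtt{\$}^w$ with $|x|>w$ let $f(x)$ be the unique prefix of $x$ lying in $S$. Let $g$ map each suffix $y$ of $T'$ to the unique suffix of $\mathtt{\#}\,T\,\mathtt{\$}^w$ that starts with $y$, except that $g(T'[n]) = \mathtt{\#}\,T\,\mathtt{\$}^w$. Let $\beta$ be the function on positions (character occurrences) of $T'$ that maps $T'[i]$, for $i<n$, to the lexicographic rank in $S$ of $f(g(T'[i+1..n]))$, and maps $T'[n]$ to the lexicographic rank in $S$ of $f(g(T')) = f(T\,\mathtt{\$}^w)$. Suppose $\beta$ maps exactly $k$ character occurrences to (the rank of) $s \in S$, all of them copies of the same character $a$, and maps a total of $t$ character occurrences to (ranks of) elements of $S$ lexicographically smaller than $s$. Then the $(t+1)$st through $(t+k)$th characters of the BWT of $T'$ are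 copies of $a$.
   Context: The Burrows--Wheeler Transform (BWT) of $T'$ is the string of length $n+1$ whose $j$th character is the character cyclically preceding the $j$th lexicographically smallest suffix of $T'$ (i.e., $T'[i-1]$ for the suffix $T'[i..n]$ with $i>0$, and $T'[n]$ for $i=0$). It is a fact (proved in the paper) that every suffix $x$ of $\mathtt{\#}\,T\,\mathtt{\$}^w$ with $|x|>w$ has exactly one prefix in $S$, and $g(y)$ always has length greater than $w$, so $\beta$ is well defined. -}

module Defs where

open import Level using (Level; _⊔_) renaming (suc to lsuc)
open import Data.Nat using (ℕ; zero; suc; _<_; _<?_; _∸_)
open import Data.List using (List; []; _∷_; _++_; map; replicate; drop; length; filter; upTo; [_])
open import Data.List.Properties using (≡-dec)
open import Data.Maybe using (Maybe; just; nothing)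
open import Data.Product using (Σ; ∃; _×_; _,_)
open import Data.Sum using (_⊎_)
open import Relation.Nullary using (¬_; yes; no)
open import Relation.Binary using (Rel; IsStrictTotalOrder; DecidableEquality; Decidable; tri<; tri≈; tri>)
open import Relation.Binary.PropositionalEquality using (_≡_; refl; cong)
import Data.List.Relation.Binary.Lex.Strict as LexS

record OrdAlph (a ℓ : Level) : Set (lsuc (a ⊔ ℓ)) where
  field
    Carrier : Set a
    _≺_     : Rel Carrier ℓ
    isSTO   : IsStrictTotalOrder _≡_ _≺_

data Ext {a} (A : Set a) : Set a where
  hash   : Ext A
  dollar : Ext A
  chr    : A → Ext A

at : ∀ {b} {B : Set b} → List B → ℕ → Maybe B
at []       _       = nothing
at (x ∷ xs) zero    = just x
at (x ∷ xs) (suc i) = at xs i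

Prefix : ∀ {b} {B : Set b} → List B → List B → Set b
Prefix p x = ∃ λ q → x ≡ p ++ q

Suffix : ∀ {b} {B : Set b} → List B → List B → Set b
Suffix s x = ∃ λ q → x ≡ q ++ s

ProperPrefix : ∀ {b} {B : Set b} → List B → List B → Set b
ProperPrefix p x = ∃ λ q → ¬ (q ≡ []) × x ≡ p ++ q

ProperSuffix : ∀ {b} {B : Set b} → List B → List B → Set b
ProperSuffix s x = ∃ λ q → ¬ (q ≡ []) × x ≡ q ++ s

Substring : ∀ {b} {B : Set b} → List B → List B → Set b
Substring m x = ∃ λ u → ∃ λ v → x ≡ u ++ m ++ v

module Setup {a ℓ e} (Alph : OrdAlph a ℓ) (w : ℕ)
             (E : List (OrdAlph.Carrier Alph) → Set e)
             (T : List (OrdAlph.Carrier Alph)) where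
  open OrdAlph Alph
  open IsStrictTotalOrder isSTO using (compare)

  data _<ᴱ_ : Rel (Ext Carrier) (a ⊔ ℓ) where
    #<$ : hash <ᴱ dollar
    #<c : ∀ {x} → hash <ᴱ chr x
    $<c : ∀ {x} → dollar <ᴱ chr x
    c<c : ∀ {x y} → x ≺ y → chr x <ᴱ chr y

  _<ˡ_ : Rel (List (Ext Carrier)) _
  _<ˡ_ = LexS.Lex-< _≡_ _<ᴱ_

  _≟ᴱ_ : DecidableEquality (Ext Carrier)
  hash ≟ᴱ hash = yes refl
  hash ≟ᴱ dollar = no λ ()
  hash ≟ᴱ chr _ = no λ ()
  dollar ≟ᴱ hash = no λ ()
  dollar ≟ᴱ dollar = yes refl
  dollar ≟ᴱ chr _ = no λ ()
  chr _ ≟ᴱ hash = no λ ()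
  chr _ ≟ᴱ dollar = no λ ()
  chr x ≟ᴱ chr y with compare x y
  ... | tri< _ x≢y _ = no λ { refl → x≢y refl }
  ... | tri≈ _ refl _ = yes refl
  ... | tri> _ x≢y _ = no λ { refl → x≢y refl }

  _<ᴱ?_ : Decidable _<ᴱ_
  hash <ᴱ? hash = no λ ()
  hash <ᴱ? dollar = yes #<$
  hash <ᴱ? chr _ = yes #<c
  dollar <ᴱ? hash = no λ ()
  dollar <ᴱ? dollar = no λ ()
  dollar <ᴱ? chr _ = yes $<c
  chr _ <ᴱ? hash = no λ ()
  chr _ <ᴱ? dollar = no λ ()
  chr x <ᴱ? chr y with compare x y
  ... | tri< x<y _ _ = yes (c<c x<y)
  ... | tri≈ x≮y _ _ = no λ { (c<c p) → x≮y p }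
  ... | tri> x≮y _ _ = no λ { (c<c p) → x≮y p }

  _≟ˡ_ : DecidableEquality (List (Ext Carrier))
  _≟ˡ_ = ≡-dec _≟ᴱ_

  _<ˡ?_ : Decidable _<ˡ_
  _<ˡ?_ = LexS.<-decidable _≟ᴱ_ _<ᴱ?_

  Str : Set a
  Str = List (Ext Carrier)

  n : ℕ
  n = length T

  X : Str
  X = hash ∷ (map chr T ++ replicate w dollar)

  T' : Str
  T' = map chr T ++ [ dollar ]

  E' : Str → Set (a ⊔ e)
  E' m = (∃ λ x → E x × m ≡ map chr x) ⊎ (m ≡ [ hash ] ⊎ m ≡ replicate w dollar)

  D : Str → Set (a ⊔ e)
  D d = Substring d X
      × (∃ λ p → ProperPrefix p d × E' p × (∀ p' → ProperPrefix p' d → E' p' → p' ≡ p))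
      × (∃ λ s → ProperSuffix s d × E' s × (∀ s' → ProperSuffix s' d → E' s' → s' ≡ s))
      × (∀ u m v → d ≡ u ++ m ++ v → E' m →
           (u ≡ [] × ¬ (v ≡ [])) ⊎ (v ≡ [] × ¬ (u ≡ [])))

  S : Str → Set (a ⊔ e)
  S x = (∃ λ d → D d × Suffix x d) × w < length x

  IsF : (Str → Str) → Set (a ⊔ e)
  IsF f = ∀ x → Suffix x X → w < length x → S (f x) × Prefix (f x) x

  -- g(T'[j..n]) : the unique suffix of X starting with T'[j..n] (= drop (j+1) X)
  -- for j < n, and g(T'[n..n]) = X.
  g : ℕ → Str
  g j with j <? n
  ... | yes _ = drop (suc j) X
  ... | no  _ = X

  -- β applied to the occurrence T'[i] (0 ≤ i ≤ n); its value is the element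
  -- of S itself (rank comparisons in S = lexicographic comparisons of elements)
  β : (Str → Str) → ℕ → Str
  β f i with i <? n
  ... | yes _ = f (g (suc i))
  ... | no  _ = f (g 0)

  positions : List ℕ
  positions = upTo (suc n)

  kOf : (Str → Str) → Str → ℕ
  kOf f s = length (filter (λ i → β f i ≟ˡ s) positions)

  tOf : (Str → Str) → Str → ℕ
  tOf f s = length (filter (λ i → β f i <ˡ? s) positions)

  -- 0-based lexicographic rank of the suffix T'[i..n] among all suffixes of T'
  rank : ℕ → ℕ
  rank i = length (filter (λ j → drop j T' <ˡ? drop i T') positions)

  -- the BWT character at the position (rank i) of the BWT: the character
  -- cyclically preceding the suffix T'[i..n]
  bwtAt : ℕ → Maybe (Ext Carrier)
  bwtAt zero    = at T' n
  bwtAt (suc i) = at T' i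

{-# OPTIONS --safe #-}
-- Write h j = f (g j) for the element of S heading the suffix T'[j..n]. Every element
-- of S ends with an E'-string, and such a string can occur inside an element of S only
-- at its start or at its end; hence no element of S is a proper prefix of another. As
-- g is strictly monotone and h j is a prefix of g j, it follows that T'[j..n] ↦ h j is
-- weakly monotone, so the suffixes j with h j = s occupy exactly the ranks t, …, t+k−1,
-- where t and k count the j with h j < s and h j = s. The map β is h composed with the
-- cyclic shift taking the occurrence T'[i] to the suffix that follows it, so it has the
-- same counts; and the BWT character at the rank of suffix j is exactly the occurrence
-- that β sends to h j.
module Submission where

open import Defs
open import Function using (_∘_)
open import Data.Empty using (⊥; ⊥-elim)
open import Data.Nat using (ℕ; zero; suc; _≤_; _<_; _+_; _∸_; z≤n; s≤s; s≤s⁻¹; _<?_)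
open import Data.Nat.Properties
  using (≤-refl; ≤-trans; ≤-reflexive; <⇒≤; <⇒≱; ≮⇒≥; <-irrefl; m≤n⇒m≤1+n; +-suc; m<m+n; m∸[m∸n]≡n)
open import Data.List
  using (List; []; _∷_; _++_; map; replicate; drop; take; length; filter; upTo; applyUpTo; [_]; _∷ʳ_)
open import Data.List.Properties
  using ( ++-assoc; ++-conicalʳ; ∷-injectiveʳ; length-map; length-replicate; length-drop
        ; length-++-≤ˡ; length-++-≤ʳ; drop-map; drop-all; take++drop≡id
        ; applyUpTo-∷ʳ; map-upTo; filter-some)
open import Data.List.Membership.Propositional using (_∈_; lose)
open import Data.List.Membership.Propositional.Properties using (∈-upTo⁺; ∈-upTo⁻)
open import Data.List.Relation.Unary.Any using (here; there)
open import Data.List.Relation.Binary.Lex.Core using (this; next; halt)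
import Data.List.Relation.Binary.Lex.Strict as Lex
open import Data.List.Relation.Binary.Pointwise using (Pointwise-≡⇒≡; ≡⇒Pointwise-≡)
import Data.List.Relation.Binary.Pointwise as Pointwise
open import Data.List.Relation.Binary.Permutation.Propositional using (_↭_; module PermutationReasoning)
open import Data.List.Relation.Binary.Permutation.Propositional.Properties using (↭-length; filter-↭; ∷↭∷ʳ)
open import Data.Maybe using (just)
open import Data.Product using (∃; ∃₂; _×_; _,_; proj₁; proj₂)
open import Data.Sum using (_⊎_; inj₁; inj₂)
open import Relation.Nullary using (¬_; yes; no)
open import Relation.Unary using (Pred) renaming (Decidable to Decidable₁)
open import Relation.Unary.Properties using (_∩?_; ∁?)
open import Relation.Binary
  using (Rel; IsStrictTotalOrder; Transitive; Trichotomous; Decidable; DecidableEquality; tri<; tri≈; tri>)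
open import Relation.Binary.PropositionalEquality
  using (_≡_; refl; sym; trans; cong; cong₂; subst; subst₂; module ≡-Reasoning)
import Relation.Binary.PropositionalEquality as ≡

module _ {b} {B : Set b} where

  drop-++ˡ : ∀ j (xs ys : List B) → j ≤ length xs → drop j (xs ++ ys) ≡ drop j xs ++ ys
  drop-++ˡ zero    xs       ys _         = refl
  drop-++ˡ (suc j) (x ∷ xs) ys (s≤s j≤) = drop-++ˡ j xs ys j≤

  length-<-drop-++ : ∀ j (xs ys : List B) → j < length xs → length ys < length (drop j (xs ++ ys))
  length-<-drop-++ zero    (x ∷ xs) ys _         = s≤s (length-++-≤ʳ ys {xs})
  length-<-drop-++ (suc j) (x ∷ xs) ys (s≤s j<) = length-<-drop-++ j xs ys j<

  drop-injective : ∀ (xs : List B) {i j} → i ≤ length xs → j ≤ length xs → drop i xs ≡ drop j xs → i ≡ j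
  drop-injective xs {i} {j} i≤ j≤ eq = begin
    i                            ≡⟨ m∸[m∸n]≡n i≤ ⟨
    length xs ∸ (length xs ∸ i)  ≡⟨ cong (length xs ∸_) |drop-i|≡|drop-j| ⟩
    length xs ∸ (length xs ∸ j)  ≡⟨ m∸[m∸n]≡n j≤ ⟩
    j                            ∎
    where
    open ≡-Reasoning
    |drop-i|≡|drop-j| : length xs ∸ i ≡ length xs ∸ j
    |drop-i|≡|drop-j| = trans (sym (length-drop i xs)) (trans (cong length eq) (length-drop j xs))

  shorter-suffix : ∀ (xs ys us vs : List B) → xs ++ ys ≡ us ++ vs → length vs ≤ length ys → Suffix vs ys
  shorter-suffix []       ys us       vs eq   _         = us , eq
  shorter-suffix (x ∷ xs) ys []       vs refl |vs|≤|ys| = ⊥-elim (<⇒≱ (s≤s (length-++-≤ʳ ys {xs})) |vs|≤|ys|)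
  shorter-suffix (x ∷ xs) ys (u ∷ us) vs eq   |vs|≤|ys| = shorter-suffix xs ys us vs (∷-injectiveʳ eq) |vs|≤|ys|

  ++⁺-Prefix : ∀ zs {xs ys : List B} → Prefix xs ys → Prefix (zs ++ xs) (zs ++ ys)
  ++⁺-Prefix zs {xs} (q , refl) = q , sym (++-assoc zs xs q)

  [x]-Prefix-replicate : ∀ {m} (x : B) → 1 ≤ m → Prefix [ x ] (replicate m x)
  [x]-Prefix-replicate x (s≤s z≤n) = replicate _ x , refl

  applyUpTo-cong : ∀ {F G : ℕ → B} m → (∀ {i} → i < m → F i ≡ G i) → applyUpTo F m ≡ applyUpTo G m
  applyUpTo-cong zero    _   = refl
  applyUpTo-cong (suc m) F≐G = cong₂ _∷_ (F≐G (s≤s z≤n)) (applyUpTo-cong m (λ i<m → F≐G (s≤s i<m)))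

count : ∀ {a p} {A : Set a} {P : Pred A p} → Decidable₁ P → List A → ℕ
count P? xs = length (filter P? xs)

module _ {a} {A : Set a} where

  count-map : ∀ {c p} {C : Set c} {P : Pred A p} (P? : Decidable₁ P) (F : C → A) xs →
              count (P? ∘ F) xs ≡ count P? (map F xs)
  count-map P? F []       = refl
  count-map P? F (x ∷ xs) with P? (F x)
  ... | yes _ = cong suc (count-map P? F xs)
  ... | no  _ = count-map P? F xs

  module _ {p q r} {P : Pred A p} {Q : Pred A q} {R : Pred A r}
           (P? : Decidable₁ P) (Q? : Decidable₁ Q) (R? : Decidable₁ R) where

    count-disjoint-≤ : ∀ xs → (∀ {x} → x ∈ xs → P x → R x) → (∀ {x} → x ∈ xs → Q x → R x) →
                       (∀ {x} → P x → Q x → ⊥) → count P? xs + count Q? xs ≤ count R? xs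
    count-disjoint-≤ []       _   _   _       = z≤n
    count-disjoint-≤ (x ∷ xs) P⊆R Q⊆R P∩Q⊆∅
      with P? x | Q? x | R? x
         | count-disjoint-≤ xs (λ x∈ → P⊆R (there x∈)) (λ x∈ → Q⊆R (there x∈)) P∩Q⊆∅
    ... | yes px | yes qx | _      | _  = ⊥-elim (P∩Q⊆∅ px qx)
    ... | yes px | no  _  | no ¬rx | _  = ⊥-elim (¬rx (P⊆R (here refl) px))
    ... | no  _  | yes qx | no ¬rx | _  = ⊥-elim (¬rx (Q⊆R (here refl) qx))
    ... | yes _  | no  _  | yes _  | ih = s≤s ih
    ... | no  _  | yes _  | yes _  | ih = ≤-trans (≤-reflexive (+-suc _ _)) (s≤s ih)
    ... | no  _  | no  _  | yes _  | ih = m≤n⇒m≤1+n ih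
    ... | no  _  | no  _  | no  _  | ih = ih

  count-< : ∀ {p q} {P : Pred A p} {Q : Pred A q} (P? : Decidable₁ P) (Q? : Decidable₁ Q) xs →
            (∀ {x} → x ∈ xs → P x → Q x) → ∀ {y} → y ∈ xs → Q y → ¬ P y → count P? xs < count Q? xs
  count-< P? Q? xs P⊆Q y∈xs Qy ¬Py =
    ≤-trans (m<m+n (count P? xs) (filter-some (Q? ∩? ∁? P?) (lose y∈xs (Qy , ¬Py))))
            (count-disjoint-≤ P? (Q? ∩? ∁? P?) Q? xs P⊆Q (λ _ → proj₁) (λ Px (_ , ¬Px) → ¬Px Px))

module _ {a ℓ} {A : Set a} {_≺_ : Rel A ℓ} where

  private
    _<ₗ_ : Rel (List A) _
    _<ₗ_ = Lex.Lex-< _≡_ _≺_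

  Lex-<-isStrictTotalOrder : IsStrictTotalOrder _≡_ _≺_ → IsStrictTotalOrder _≡_ _<ₗ_
  Lex-<-isStrictTotalOrder sto = record
    { isStrictPartialOrder = record
      { isEquivalence = ≡.isEquivalence
      ; irrefl        = λ { refl → Lex.<-irreflexive A.irrefl (Pointwise.refl refl) }
      ; trans         = Lex.<-transitive ≡.isEquivalence (≡.resp₂ _≺_) A.trans
      ; <-resp-≈      = ≡.resp₂ _<ₗ_
      }
    ; compare = compare-≡
    }
    where
    module A = IsStrictTotalOrder sto
    compare-≡ : Trichotomous _≡_ _<ₗ_
    compare-≡ xs ys with Lex.<-compare sym A.compare xs ys
    ... | tri< xs<ys xs≉ys ys≮xs = tri< xs<ys (xs≉ys ∘ ≡⇒Pointwise-≡) ys≮xs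
    ... | tri≈ xs≮ys xs≈ys ys≮xs = tri≈ xs≮ys (Pointwise-≡⇒≡ xs≈ys) ys≮xs
    ... | tri> xs≮ys xs≉ys ys<xs = tri> xs≮ys (xs≉ys ∘ ≡⇒Pointwise-≡) ys<xs

  extensions-<⊎ProperPrefix : ∀ {p p′ x x′} → p <ₗ p′ → Prefix p x → Prefix p′ x′ →
                              x <ₗ x′ ⊎ ProperPrefix p p′
  extensions-<⊎ProperPrefix halt          _          _            = inj₂ (_ , (λ ()) , refl)
  extensions-<⊎ProperPrefix (this x≺y)    (_ , refl) (_ , refl)   = inj₁ (this x≺y)
  extensions-<⊎ProperPrefix (next refl r) (q , refl) (q′ , refl)
    with extensions-<⊎ProperPrefix r (q , refl) (q′ , refl)
  ... | inj₁ x<x′              = inj₁ (next refl x<x′)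
  ... | inj₂ (q₀ , q₀≢[] , eq) = inj₂ (q₀ , q₀≢[] , cong (_ ∷_) eq)

module RankBlock {a b c ℓ₁ ℓ₂} {I : Set a} {K : Set b} {V : Set c}
                 {_<ₖ_ : Rel K ℓ₁} {_<ᵥ_ : Rel V ℓ₂}
                 (K-sto : IsStrictTotalOrder _≡_ _<ₖ_) (V-sto : IsStrictTotalOrder _≡_ _<ᵥ_)
                 (_<ₖ?_ : Decidable _<ₖ_) (_<ᵥ?_ : Decidable _<ᵥ_) (_≟ᵥ_ : DecidableEquality V)
                 (L : List I) (key : I → K) (val : I → V)
                 (key-injective : ∀ {i j} → i ∈ L → j ∈ L → key i ≡ key j → i ≡ j)
                 (val-monotone : ∀ {i j} → i ∈ L → j ∈ L → key j <ₖ key i → ¬ val i <ᵥ val j)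
                 where

  private
    module K = IsStrictTotalOrder K-sto
    module V = IsStrictTotalOrder V-sto

  rank : I → ℕ
  rank i = count (λ j → key j <ₖ? key i) L

  below : V → ℕ
  below s = count (λ j → val j <ᵥ? s) L

  hits : V → ℕ
  hits s = count (λ j → val j ≟ᵥ s) L

  val-reflects-< : ∀ {i j} → i ∈ L → j ∈ L → val j <ᵥ val i → key j <ₖ key i
  val-reflects-< {i} {j} i∈L j∈L vj<vi with K.compare (key j) (key i)
  ... | tri< kj<ki _ _ = kj<ki
  ... | tri> _ _ ki<kj = ⊥-elim (val-monotone j∈L i∈L ki<kj vj<vi)
  ... | tri≈ _ kj≡ki _ with key-injective j∈L i∈L kj≡ki
  ...   | refl = ⊥-elim (V.irrefl refl vj<vi)

  rank<below : ∀ {i s} → i ∈ L → val i <ᵥ s → rank i < below s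
  rank<below {i} {s} i∈L vi<s = count-< _ _ L key-below⇒val-below i∈L vi<s (K.irrefl refl)
    where
    key-below⇒val-below : ∀ {j} → j ∈ L → key j <ₖ key i → val j <ᵥ s
    key-below⇒val-below {j} j∈L kj<ki with V.compare (val j) (val i)
    ... | tri< vj<vi _ _ = V.trans vj<vi vi<s
    ... | tri≈ _ vj≡vi _ = subst (_<ᵥ s) (sym vj≡vi) vi<s
    ... | tri> _ _ vi<vj = ⊥-elim (val-monotone i∈L j∈L kj<ki vi<vj)

  below+hits≤rank : ∀ {i s} → i ∈ L → s <ᵥ val i → below s + hits s ≤ rank i
  below+hits≤rank {i} {s} i∈L s<vi = count-disjoint-≤ _ _ _ L
    (λ j∈L vj<s → val-reflects-< i∈L j∈L (V.trans vj<s s<vi))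
    (λ j∈L vj≡s → val-reflects-< i∈L j∈L (subst (_<ᵥ val i) (sym vj≡s) s<vi))
    (λ vj<s vj≡s → V.irrefl vj≡s vj<s)

  block-value : ∀ {i s} → i ∈ L → below s ≤ rank i → rank i < below s + hits s → val i ≡ s
  block-value {i} {s} i∈L b≤r r<b+h with V.compare (val i) s
  ... | tri< vi<s _ _ = ⊥-elim (<⇒≱ (rank<below i∈L vi<s) b≤r)
  ... | tri≈ _ vi≡s _ = vi≡s
  ... | tri> _ _ s<vi = ⊥-elim (<⇒≱ r<b+h (below+hits≤rank i∈L s<vi))

module Properties {a ℓ e} (Alph : OrdAlph a ℓ) (w : ℕ) (1≤w : 1 ≤ w)
                  (E : List (OrdAlph.Carrier Alph) → Set e)
                  (E-length : ∀ x → E x → length x ≡ w)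
                  (T : List (OrdAlph.Carrier Alph)) where

  open OrdAlph Alph
  open Setup Alph w E T
  private module Σ = IsStrictTotalOrder isSTO

  <ᴱ-trans : Transitive _<ᴱ_
  <ᴱ-trans #<$     $<c     = #<c
  <ᴱ-trans #<c     (c<c _) = #<c
  <ᴱ-trans $<c     (c<c _) = $<c
  <ᴱ-trans (c<c p) (c<c q) = c<c (Σ.trans p q)

  <ᴱ-compare : Trichotomous _≡_ _<ᴱ_
  <ᴱ-compare hash    hash    = tri≈ (λ ()) refl (λ ())
  <ᴱ-compare hash    dollar  = tri< #<$ (λ ()) (λ ())
  <ᴱ-compare hash    (chr _) = tri< #<c (λ ()) (λ ())
  <ᴱ-compare dollar  hash    = tri> (λ ()) (λ ()) #<$
  <ᴱ-compare dollar  dollar  = tri≈ (λ ()) refl (λ ())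
  <ᴱ-compare dollar  (chr _) = tri< $<c (λ ()) (λ ())
  <ᴱ-compare (chr _) hash    = tri> (λ ()) (λ ()) #<c
  <ᴱ-compare (chr _) dollar  = tri> (λ ()) (λ ()) $<c
  <ᴱ-compare (chr x) (chr y) with Σ.compare x y
  ... | tri< x<y x≢y y≮x = tri< (c<c x<y) (λ { refl → x≢y refl }) (λ { (c<c y<x) → y≮x y<x })
  ... | tri≈ x≮y refl y≮x = tri≈ (λ { (c<c x<y) → x≮y x<y }) refl (λ { (c<c y<x) → y≮x y<x })
  ... | tri> x≮y x≢y y<x = tri> (λ { (c<c x<y) → x≮y x<y }) (λ { refl → x≢y refl }) (c<c y<x)

  <ᴱ-isStrictTotalOrder : IsStrictTotalOrder _≡_ _<ᴱ_
  <ᴱ-isStrictTotalOrder = record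
    { isStrictPartialOrder = record
      { isEquivalence = ≡.isEquivalence
      ; irrefl        = λ { refl (c<c x<x) → Σ.irrefl refl x<x }
      ; trans         = <ᴱ-trans
      ; <-resp-≈      = ≡.resp₂ _<ᴱ_
      }
    ; compare = <ᴱ-compare
    }

  <ˡ-isStrictTotalOrder : IsStrictTotalOrder _≡_ _<ˡ_
  <ˡ-isStrictTotalOrder = Lex-<-isStrictTotalOrder <ᴱ-isStrictTotalOrder

  private module Strˡ = IsStrictTotalOrder <ˡ-isStrictTotalOrder

  E'-length : ∀ {m} → E' m → length m ≤ w
  E'-length (inj₁ (x , Ex , refl)) = ≤-reflexive (trans (length-map chr x) (E-length x Ex))
  E'-length (inj₂ (inj₁ refl))     = 1≤w
  E'-length (inj₂ (inj₂ refl))     = ≤-reflexive (length-replicate w)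

  S-ends-in-E' : ∀ {p} → S p → ∃₂ λ m e → p ≡ m ++ e × E' e
  S-ends-in-E' {p} ((d , (_ , _ , (e , (r , _ , d≡r++e) , e∈E' , _) , _) , (q , d≡q++p)) , w<|p|)
    with shorter-suffix q p r e (trans (sym d≡q++p) d≡r++e) (≤-trans (E'-length e∈E') (<⇒≤ w<|p|))
  ... | m , p≡m++e = m , e , p≡m++e , e∈E'

  S-E'-occurrence : ∀ {p u e v} → S p → p ≡ u ++ e ++ v → E' e → ¬ v ≡ [] → u ≡ []
  S-E'-occurrence {p} {u} {e} {v} ((d , (_ , _ , _ , occurrence) , (q , d≡q++p)) , _) p≡u++e++v e∈E' v≢[]
    with occurrence (q ++ u) e v
           (trans d≡q++p (trans (cong (q ++_) p≡u++e++v) (sym (++-assoc q u (e ++ v))))) e∈E'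
  ... | inj₁ (q++u≡[] , _) = ++-conicalʳ q u q++u≡[]
  ... | inj₂ (v≡[] , _)    = ⊥-elim (v≢[] v≡[])

  S-prefix-free : ∀ {p p′} → S p → S p′ → ¬ ProperPrefix p p′
  S-prefix-free Sp Sp′ (q , q≢[] , p′≡p++q) with S-ends-in-E' Sp
  ... | m , e , refl , e∈E' with S-E'-occurrence {u = m} Sp′ (trans p′≡p++q (++-assoc m e q)) e∈E' q≢[]
  ...   | refl = <⇒≱ (proj₂ Sp) (E'-length e∈E')

  U : Str
  U = map chr T

  -- X ≡ hash ∷ Y, so g j ≡ drop j Y for j < n.
  Y : Str
  Y = U ++ replicate w dollar

  ≤n⇒≤|U| : ∀ {j} → j ≤ n → j ≤ length U
  ≤n⇒≤|U| = subst (_ ≤_) (sym (length-map chr T))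

  drop-T' : ∀ {j} → j ≤ n → drop j T' ≡ map chr (drop j T) ++ [ dollar ]
  drop-T' {j} j≤n = trans (drop-++ˡ j U [ dollar ] (≤n⇒≤|U| j≤n)) (cong (_++ [ dollar ]) (drop-map j T))

  drop-T'-injective : ∀ {i j} → i ≤ n → j ≤ n → drop i T' ≡ drop j T' → i ≡ j
  drop-T'-injective i≤n j≤n = drop-injective T' (≤-trans (≤n⇒≤|U| i≤n) (length-++-≤ˡ U))
                                                (≤-trans (≤n⇒≤|U| j≤n) (length-++-≤ˡ U))

  drop-T'-Prefix : ∀ {j} → j ≤ n → Prefix (drop j T') (drop j Y)
  drop-T'-Prefix {j} j≤n =
    subst₂ Prefix (sym (drop-++ˡ j U _ (≤n⇒≤|U| j≤n))) (sym (drop-++ˡ j U _ (≤n⇒≤|U| j≤n)))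
      (++⁺-Prefix (drop j U) ([x]-Prefix-replicate dollar 1≤w))

  $-terminated-prefix-free : ∀ (xs ys : List Carrier) →
                             ¬ ProperPrefix (map chr xs ++ [ dollar ]) (map chr ys ++ [ dollar ])
  $-terminated-prefix-free []       []       (q , q≢[] , eq) = q≢[] (sym (∷-injectiveʳ eq))
  $-terminated-prefix-free []       (y ∷ ys) (_ , _ , ())
  $-terminated-prefix-free (x ∷ xs) []       (_ , _ , ())
  $-terminated-prefix-free (x ∷ xs) (y ∷ ys) (q , q≢[] , eq) =
    $-terminated-prefix-free xs ys (q , q≢[] , ∷-injectiveʳ eq)

  ¬$-terminated<[$] : ∀ (xs : List Carrier) → ¬ (map chr xs ++ [ dollar ]) <ˡ [ dollar ]
  ¬$-terminated<[$] []      = Strˡ.irrefl refl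
  ¬$-terminated<[$] (x ∷ _) (this ())
  ¬$-terminated<[$] (x ∷ _) (next () _)

  hash∷-<-$-terminated : ∀ {Z} (xs : List Carrier) q → (hash ∷ Z) <ˡ ((map chr xs ++ [ dollar ]) ++ q)
  hash∷-<-$-terminated []      _ = this #<$
  hash∷-<-$-terminated (_ ∷ _) _ = this #<c

  g-suffix : ∀ j → Suffix (g j) X
  g-suffix j with j <? n
  ... | yes _ = take (suc j) X , sym (take++drop≡id (suc j) X)
  ... | no  _ = [] , refl

  g-long : ∀ j → w < length (g j)
  g-long j with j <? n
  ... | yes j<n = subst (_< length (drop j Y)) (length-replicate w)
                    (length-<-drop-++ j U _ (subst (j <_) (sym (length-map chr T)) j<n))
  ... | no  _   = subst (_< length X) (length-replicate w) (s≤s (length-++-≤ʳ (replicate w dollar) {U}))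

  g-monotone : ∀ {i j} → i ≤ n → j ≤ n → drop j T' <ˡ drop i T' → g j <ˡ g i
  g-monotone {i} {j} i≤n j≤n Tⱼ<Tᵢ with i <? n | j <? n
  ... | no i≮n | _ =
    ⊥-elim (¬$-terminated<[$] (drop j T) (subst₂ _<ˡ_ (drop-T' j≤n) Tᵢ≡[$] Tⱼ<Tᵢ))
    where
    Tᵢ≡[$] : drop i T' ≡ [ dollar ]
    Tᵢ≡[$] = trans (drop-T' i≤n) (cong (λ xs → map chr xs ++ [ dollar ]) (drop-all i T (≮⇒≥ i≮n)))
  ... | yes _ | no _ with drop-T'-Prefix i≤n
  ...   | q , Yᵢ≡Tᵢ++q = subst (X <ˡ_) (sym (trans Yᵢ≡Tᵢ++q (cong (_++ q) (drop-T' i≤n))))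
                                (hash∷-<-$-terminated (drop i T) q)
  g-monotone {i} {j} i≤n j≤n Tⱼ<Tᵢ | yes _ | yes _
    with extensions-<⊎ProperPrefix Tⱼ<Tᵢ (drop-T'-Prefix j≤n) (drop-T'-Prefix i≤n)
  ... | inj₁ gⱼ<gᵢ = gⱼ<gᵢ
  ... | inj₂ Tⱼ⊏Tᵢ = ⊥-elim ($-terminated-prefix-free (drop j T) (drop i T)
                              (subst₂ ProperPrefix (drop-T' j≤n) (drop-T' i≤n) Tⱼ⊏Tᵢ))

  ∈-positions⁻ : ∀ {j} → j ∈ positions → j ≤ n
  ∈-positions⁻ = s≤s⁻¹ ∘ ∈-upTo⁻

  module _ (f : Str → Str) (f-spec : IsF f) where

    h : ℕ → Str
    h j = f (g j)

    h-spec : ∀ j → S (h j) × Prefix (h j) (g j)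
    h-spec j = f-spec (g j) (g-suffix j) (g-long j)

    h-monotone : ∀ {i j} → i ≤ n → j ≤ n → drop j T' <ˡ drop i T' → ¬ h i <ˡ h j
    h-monotone {i} {j} i≤n j≤n Tⱼ<Tᵢ hᵢ<hⱼ
      with extensions-<⊎ProperPrefix hᵢ<hⱼ (proj₂ (h-spec i)) (proj₂ (h-spec j))
    ... | inj₁ gᵢ<gⱼ = Strˡ.asym gᵢ<gⱼ (g-monotone i≤n j≤n Tⱼ<Tᵢ)
    ... | inj₂ hᵢ⊏hⱼ = S-prefix-free (proj₁ (h-spec i)) (proj₁ (h-spec j)) hᵢ⊏hⱼ

    β-below : ∀ {i} → i < n → β f i ≡ h (suc i)
    β-below {i} i<n with i <? n
    ... | yes _   = refl
    ... | no i≮n = ⊥-elim (i≮n i<n)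

    β-last : β f n ≡ h 0
    β-last with n <? n
    ... | yes n<n = ⊥-elim (<-irrefl refl n<n)
    ... | no  _   = refl

    map-β↭map-h : map (β f) positions ↭ map h positions
    map-β↭map-h = begin
      map (β f) (upTo (suc n))      ≡⟨ map-upTo (β f) (suc n) ⟩
      applyUpTo (β f) (suc n)       ≡⟨ applyUpTo-∷ʳ (β f) n ⟨
      applyUpTo (β f) n ∷ʳ β f n    ≡⟨ cong₂ _∷ʳ_ (applyUpTo-cong n β-below) β-last ⟩
      applyUpTo (h ∘ suc) n ∷ʳ h 0  ↭⟨ ∷↭∷ʳ (h 0) _ ⟨
      applyUpTo h (suc n)           ≡⟨ map-upTo h (suc n) ⟨
      map h (upTo (suc n))          ∎
      where open PermutationReasoning

    count-β : ∀ {p} {P : Pred Str p} (P? : Decidable₁ P) →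
              count (P? ∘ β f) positions ≡ count (P? ∘ h) positions
    count-β P? = begin
      count (P? ∘ β f) positions      ≡⟨ count-map P? (β f) positions ⟩
      count P? (map (β f) positions)  ≡⟨ ↭-length (filter-↭ P? map-β↭map-h) ⟩
      count P? (map h positions)      ≡⟨ count-map P? h positions ⟨
      count (P? ∘ h) positions        ∎
      where open ≡-Reasoning

    h-block : ∀ {s i} → i ≤ n → tOf f s ≤ rank i → rank i < tOf f s + kOf f s → h i ≡ s
    h-block {s} {i} i≤n t≤rank rank<t+k =
      block-value (∈-upTo⁺ (s≤s i≤n))
        (subst (_≤ rank i) (count-β (_<ˡ? s)) t≤rank)
        (subst (rank i <_) (cong₂ _+_ (count-β (_<ˡ? s)) (count-β (_≟ˡ s))) rank<t+k)
      where
      open RankBlock <ˡ-isStrictTotalOrder <ˡ-isStrictTotalOrder _<ˡ?_ _<ˡ?_ _≟ˡ_ positions (λ j → drop j T') h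
             (λ i∈ j∈ → drop-T'-injective (∈-positions⁻ i∈) (∈-positions⁻ j∈))
             (λ i∈ j∈ → h-monotone (∈-positions⁻ i∈) (∈-positions⁻ j∈))
             using (block-value)

    preceding-occurrence : ∀ {i} → i ≤ n → ∃ λ j → j ≤ n × β f j ≡ h i × bwtAt i ≡ at T' j
    preceding-occurrence {zero}  _   = n , ≤-refl , β-last , refl
    preceding-occurrence {suc i} i<n = i , <⇒≤ i<n , β-below i<n , refl

lemma6 : ∀ {a ℓ e} (Alph : OrdAlph a ℓ) (w : ℕ) → 1 ≤ w →
         (E : List (OrdAlph.Carrier Alph) → Set e) →
         (∀ x → E x → length x ≡ w) →
         (T : List (OrdAlph.Carrier Alph)) →
         let open Setup Alph w E T in
         (f : Str → Str) → IsF f →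
         (s : Str) → S s → (c : Ext (OrdAlph.Carrier Alph)) →
         (∀ i → i ≤ n → β f i ≡ s → at T' i ≡ just c) →
         ∀ i → i ≤ n → tOf f s ≤ rank i → rank i < tOf f s + kOf f s →
         bwtAt i ≡ just c
lemma6 Alph w 1≤w E E-length T f f-spec s _ c β⁻¹[s]⊆c i i≤n t≤rank rank<t+k =
  let open Properties Alph w 1≤w E E-length T
      (j , j≤n , βⱼ≡hᵢ , bwtᵢ≡Tⱼ) = preceding-occurrence f f-spec i≤n
  in trans bwtᵢ≡Tⱼ (β⁻¹[s]⊆c j j≤n (trans βⱼ≡hᵢ (h-block f f-spec i≤n t≤rank rank<t+k)))
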